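{- Every $12$-representable graph belongs to $\mathcal{G}_2$.
   Context: For a word $w$, $\mathrm{alph}(w)$ is the set of letters occurring in $w$ and $|w|_a$ the number of occurrences of $a$; $w$ is $k$-uniform if $|w|_a=k$ for all $a\in\mathrm{alph}(w)$. For letters $a,b$, $\pi_{a,b}$ is the monoid morphism on words with $a\mapsto a$, $b\mapsto b$ and all other letters mapped to the empty word. For words $w,v$ with $\mathrm{alph}(w)=\mathrm{alph}(v)=A$, $G(w,v)$ is the undirected simple graph on vertex set $A$ in which distinct $a,b$ are adjacent iff $\pi_{a,b}(w)=\pi_{a,b}(v)$. For $k\in\mathbb{N}$, $\mathcal{G}_k$ is the set of graphs $G$ for which there exist $k$-uniform words $w,v\in V(G)^\ast$ with $G=G(w,v)$. For a word $w$ over $\mathbb{N}$, its reduction $\mathrm{red}(w)$ is obtained by replacing each occurrence of the $i$-th smallest letter of $w$ by $i$. A word $w$ over $\mathbb{N}$ has a $12$-match if it has a factor $f$ (contiguous subword) with $\mathrm{red}(f)=12$, i.e. two consecutive letters $x,y$ with $x<y$. A graph $G=(V,E)$ with $V\subseteq\mathbb{N}$ is $12$-representable if there exists a word $w$ over $\mathbb{N}$ with $\mathrm{alph}(w)=V$ such that for all distinct $i,j\in V$: $\{i,j\}\in E$ iff $\pi_{i,j}(w)$ has no $12$-match. -}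

module Defs where

open import Data.Nat using (ℕ; zero; suc; _<_; _≡ᵇ_)
open import Data.Bool using (Bool; true; false; if_then_else_; _∨_)
open import Data.List using (List; []; _∷_)
open import Data.List.Membership.Propositional using (_∈_)
open import Data.List.Relation.Unary.Unique.Propositional using (Unique)
open import Data.Product using (Σ; _×_; ∃)
open import Relation.Nullary using (¬_)
open import Relation.Binary.PropositionalEquality using (_≡_; _≢_)
open import Function.Bundles using (_⇔_)

Word : Set
Word = List ℕ

count : ℕ → Word → ℕ
count a [] = zero
count a (x ∷ w) = if x ≡ᵇ a then suc (count a w) else count a w

Uniform : ℕ → Word → Set
Uniform k w = ∀ a → a ∈ w → count a w ≡ k

AlphIs : Word → List ℕ → Set
AlphIs w V = ∀ a → (a ∈ w) ⇔ (a ∈ V)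

proj : ℕ → ℕ → Word → Word
proj a b [] = []
proj a b (x ∷ w) = if (x ≡ᵇ a) ∨ (x ≡ᵇ b) then x ∷ proj a b w else proj a b w

data Has12 : Word → Set where
  here  : ∀ {x y w} → x < y → Has12 (x ∷ y ∷ w)
  there : ∀ {x w} → Has12 w → Has12 (x ∷ w)

record Graph : Set₁ where
  field
    V        : List ℕ
    V-unique : Unique V
    E        : ℕ → ℕ → Set
    E-sym    : ∀ {i j} → E i j → E j i
    E-irrefl : ∀ {i} → ¬ E i i
    E-inV    : ∀ {i j} → E i j → (i ∈ V) × (j ∈ V)
open Graph public

Rep12 : Graph → Set
Rep12 G = Σ Word λ w → AlphIs w (V G) ×
  (∀ i j → i ∈ V G → j ∈ V G → i ≢ j → E G i j ⇔ (¬ Has12 (proj i j w)))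

IsG : Graph → Word → Word → Set
IsG G w v = AlphIs w (V G) × AlphIs v (V G) ×
  (∀ a b → a ∈ V G → b ∈ V G → a ≢ b → E G a b ⇔ (proj a b w ≡ proj a b v))

InGk : ℕ → Graph → Set
InGk k G = Σ Word λ w → Σ Word λ v → Uniform k w × Uniform k v × IsG G w v

{-# OPTIONS --safe #-}
module Submission where

-- For i < j, the projection of w to {i, j} has no 12-match iff no i occurs before a j in w.
-- This order information is captured by the 2-uniform word e(w) that writes every letter at its
-- first and at its last occurrence in w: its projection to {i, j} is jjii exactly when no i
-- occurs before a j in w. The decreasing rearrangement d of w has no i before a j for any
-- i < j, so all projections of e(d) are jjii, and G = G(e(w), e(d)).

open import Defs
open import Data.Bool using (true; false; if_then_else_; _∨_)
open import Data.Empty using (⊥-elim)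
open import Data.Nat using (ℕ; zero; suc; _+_; _<_; _≥_; _≡ᵇ_)
open import Data.Nat.Properties using (_≟_; <-irrefl; <-asym; <⇒≱; <⇒≢; <-cmp; ≤-decTotalOrder)
open import Data.List using ([]; _∷_; _++_; filter; replicate)
open import Data.List.Properties using (filter-accept; filter-≐)
open import Data.List.Membership.Propositional using (_∈_)
open import Data.List.Membership.Propositional.Properties using (∈-++⁺ʳ; ∈-++⁻; ∈-filter⁺; ∈-filter⁻)
open import Data.List.Relation.Unary.Any using (here; there)
open import Data.List.Relation.Unary.All as All using (All; []; _∷_)
open import Data.List.Relation.Unary.All.Properties using (all-filter; ++⁺)
open import Data.List.Relation.Unary.AllPairs using (AllPairs; _∷_)
open import Data.Product using (_×_; _,_; proj₁)
open import Data.Sum using (_⊎_; inj₁; inj₂; swap)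
open import Relation.Nullary using (¬_; yes; no; does; _⊎-dec_)
open import Relation.Nullary.Decidable using (dec-true; dec-false; decidable-stable)
open import Relation.Unary using (Decidable)
open import Relation.Binary.PropositionalEquality
  using (_≡_; _≢_; refl; sym; trans; cong; cong₂; subst; ≢-sym; module ≡-Reasoning)
open import Function using (_∘_)
open import Function.Bundles using (_⇔_; mk⇔; Equivalence)
open import Function.Construct.Composition using (_⇔-∘_)
open import Function.Related.TypeIsomorphisms using (¬-cong-⇔)
open import Level using (0ℓ)
open import Relation.Binary using (DecTotalOrder; tri<; tri≈; tri>)
import Relation.Binary.Construct.Flip.EqAndOrd as Flip
import Data.List.Sort as Sort
open import Data.List.Relation.Unary.Sorted.TotalOrder.Properties using (Sorted⇒AllPairs)
open import Data.List.Relation.Binary.Subset.Propositional using (_⊆_)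
open import Data.List.Relation.Binary.Permutation.Propositional using (↭-sym)
open import Data.List.Relation.Binary.Permutation.Propositional.Properties using (∈-resp-↭)
open ≡-Reasoning

≡ᵇ-refl : ∀ n → (n ≡ᵇ n) ≡ true
≡ᵇ-refl n = dec-true (n ≟ n) refl

≢⇒≡ᵇ-false : ∀ {m n} → m ≢ n → (m ≡ᵇ n) ≡ false
≢⇒≡ᵇ-false {m} {n} = dec-false (m ≟ n)

count-here : ∀ x u → count x (x ∷ u) ≡ suc (count x u)
count-here x u rewrite ≡ᵇ-refl x = refl

count-there : ∀ {x y} u → y ≢ x → count x (y ∷ u) ≡ count x u
count-there u y≢x rewrite ≢⇒≡ᵇ-false y≢x = refl

count-++ : ∀ x u v → count x (u ++ v) ≡ count x u + count x v
count-++ x [] v = refl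
count-++ x (y ∷ u) v with y ≡ᵇ x
... | true = cong suc (count-++ x u v)
... | false = count-++ x u v

∈⇒count≢0 : ∀ {x u} → x ∈ u → count x u ≢ 0
∈⇒count≢0 {x} (here refl) rewrite ≡ᵇ-refl x = λ ()
∈⇒count≢0 {x} {y ∷ u} (there x∈u) with y ≡ᵇ x
... | true = λ ()
... | false = ∈⇒count≢0 x∈u

count≢0⇒∈ : ∀ {x} u → count x u ≢ 0 → x ∈ u
count≢0⇒∈ [] c≢0 = ⊥-elim (c≢0 refl)
count≢0⇒∈ {x} (y ∷ u) c≢0 with y ≟ x
... | yes refl = here refl
... | no y≢x = there (count≢0⇒∈ u (subst (_≢ 0) (count-there u y≢x) c≢0))

module _ {P : ℕ → Set} (P? : Decidable P) where

  count-filter : ∀ {x} → P x → ∀ u → count x (filter P? u) ≡ count x u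
  count-filter Px [] = refl
  count-filter {x} Px (y ∷ u) with y ≟ x
  ... | yes refl = begin
    count y (filter P? (y ∷ u)) ≡⟨ cong (count y) (filter-accept P? Px) ⟩
    count y (y ∷ filter P? u)   ≡⟨ count-here y (filter P? u) ⟩
    suc (count y (filter P? u)) ≡⟨ cong suc (count-filter Px u) ⟩
    suc (count y u)             ≡⟨ count-here y u ⟨
    count y (y ∷ u)             ∎
  ... | no y≢x with does (P? y)
  ...   | true = trans (count-there (filter P? u) y≢x) (trans (count-filter Px u) (sym (count-there u y≢x)))
  ...   | false = trans (count-filter Px u) (sym (count-there u y≢x))

Pair : ℕ → ℕ → ℕ → Set
Pair i j x = x ≡ i ⊎ x ≡ j

pair? : ∀ i j → Decidable (Pair i j)
pair? i j x = (x ≟ i) ⊎-dec (x ≟ j)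

proj≡filter : ∀ i j u → proj i j u ≡ filter (pair? i j) u
proj≡filter i j [] = refl
proj≡filter i j (x ∷ u) with (x ≡ᵇ i) ∨ (x ≡ᵇ j)
... | true = cong (x ∷_) (proj≡filter i j u)
... | false = proj≡filter i j u

proj-comm : ∀ i j u → proj i j u ≡ proj j i u
proj-comm i j u = begin
  proj i j u                ≡⟨ proj≡filter i j u ⟩
  filter (pair? i j) u      ≡⟨ filter-≐ (pair? i j) (pair? j i) (swap , swap) u ⟩
  filter (pair? j i) u      ≡⟨ proj≡filter j i u ⟨
  proj j i u                ∎


proj-pair : ∀ i j u → All (Pair i j) (proj i j u)
proj-pair i j u = subst (All (Pair i j)) (sym (proj≡filter i j u)) (all-filter (pair? i j) u)

count-proj : ∀ {i j x} → Pair i j x → ∀ u → count x (proj i j u) ≡ count x u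
count-proj {i} {j} {x} px u = trans (cong (count x) (proj≡filter i j u)) (count-filter (pair? i j) px u)

data Before (i j : ℕ) : Word → Set where
  bhere  : ∀ {u} → j ∈ u → Before i j (i ∷ u)
  bthere : ∀ {x u} → Before i j u → Before i j (x ∷ u)

module _ {i j : ℕ} where

  Before⇒∈ : ∀ {u} → Before i j u → j ∈ u
  Before⇒∈ (bhere j∈u) = there j∈u
  Before⇒∈ (bthere b) = there (Before⇒∈ b)

  Before-∷⇒∈ : ∀ {x u} → Before i j (x ∷ u) → j ∈ u
  Before-∷⇒∈ (bhere j∈u) = j∈u
  Before-∷⇒∈ (bthere b) = Before⇒∈ b

  Before-++⁺ʳ : ∀ v {u} → Before i j u → Before i j (v ++ u)
  Before-++⁺ʳ [] b = b
  Before-++⁺ʳ (x ∷ v) b = bthere (Before-++⁺ʳ v b)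

  Before-constant-++⁻ : ∀ {x v u} → i ≢ j → All (_≡ x) v → Before i j (v ++ u) →
                        (x ≡ i × j ∈ u) ⊎ Before i j u
  Before-constant-++⁻ i≢j [] b = inj₂ b
  Before-constant-++⁻ {v = y ∷ v} {u} i≢j (refl ∷ v≡x) (bhere j∈v++u) with ∈-++⁻ v j∈v++u
  ... | inj₁ j∈v = ⊥-elim (i≢j (sym (All.lookup v≡x j∈v)))
  ... | inj₂ j∈u = inj₁ (refl , j∈u)
  Before-constant-++⁻ i≢j (_ ∷ v≡x) (bthere b) = Before-constant-++⁻ i≢j v≡x b

  module _ {P : ℕ → Set} (P? : Decidable P) where

    Before-filter⁺ : P i → P j → ∀ {u} → Before i j u → Before i j (filter P? u)
    Before-filter⁺ Pi Pj (bhere {u} j∈u) =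
      subst (Before i j) (sym (filter-accept P? Pi)) (bhere (∈-filter⁺ P? j∈u Pj))
    Before-filter⁺ Pi Pj (bthere {x} b) with does (P? x)
    ... | true = bthere (Before-filter⁺ Pi Pj b)
    ... | false = Before-filter⁺ Pi Pj b

    Before-filter⁻ : ∀ u → Before i j (filter P? u) → Before i j u
    Before-filter⁻ (x ∷ u) b with does (P? x) | b
    ... | true | bhere j∈u = bhere (proj₁ (∈-filter⁻ P? j∈u))
    ... | true | bthere b′ = bthere (Before-filter⁻ u b′)
    ... | false | b′ = bthere (Before-filter⁻ u b′)

  Before-proj⁺ : ∀ {u} → Before i j u → Before i j (proj i j u)
  Before-proj⁺ {u} b = subst (Before i j) (sym (proj≡filter i j u))
    (Before-filter⁺ (pair? i j) (inj₁ refl) (inj₂ refl) b)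

  Before-proj⁻ : ∀ u → Before i j (proj i j u) → Before i j u
  Before-proj⁻ u b = Before-filter⁻ (pair? i j) u (subst (Before i j) (proj≡filter i j u) b)

  module _ (i<j : i < j) where

    Has12⇒Before : ∀ {u} → All (Pair i j) u → Has12 u → Before i j u
    Has12⇒Before (inj₁ refl ∷ inj₁ refl ∷ _) (here i<i) = ⊥-elim (<-irrefl refl i<i)
    Has12⇒Before (inj₁ refl ∷ inj₂ refl ∷ _) (here _) = bhere (here refl)
    Has12⇒Before (inj₂ refl ∷ inj₁ refl ∷ _) (here j<i) = ⊥-elim (<-asym i<j j<i)
    Has12⇒Before (inj₂ refl ∷ inj₂ refl ∷ _) (here j<j) = ⊥-elim (<-irrefl refl j<j)
    Has12⇒Before (_ ∷ ps) (there h) = bthere (Has12⇒Before ps h)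

    Has12-∷ : ∀ {u} → All (Pair i j) u → j ∈ u → Has12 (i ∷ u)
    Has12-∷ (_ ∷ _) (here refl) = here i<j
    Has12-∷ (inj₁ refl ∷ ps) (there j∈u) = there (Has12-∷ ps j∈u)
    Has12-∷ (inj₂ refl ∷ _) (there _) = here i<j

    Before⇒Has12 : ∀ {u} → All (Pair i j) u → Before i j u → Has12 u
    Before⇒Has12 (_ ∷ ps) (bhere j∈u) = Has12-∷ ps j∈u
    Before⇒Has12 (_ ∷ ps) (bthere b) = there (Before⇒Has12 ps b)

    Has12-proj⇔Before : ∀ u → Has12 (proj i j u) ⇔ Before i j u
    Has12-proj⇔Before u = mk⇔
      (Before-proj⁻ u ∘ Has12⇒Before (proj-pair i j u))
      (Before⇒Has12 (proj-pair i j u) ∘ Before-proj⁺)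

    AllPairs≥⇒¬Before : ∀ {u} → AllPairs _≥_ u → ¬ Before i j u
    AllPairs≥⇒¬Before (i≥u ∷ _) (bhere j∈u) = <⇒≱ i<j (All.lookup i≥u j∈u)
    AllPairs≥⇒¬Before (_ ∷ u≥) (bthere b) = AllPairs≥⇒¬Before u≥ b

  ¬Before-∷⇒count≡0 : ∀ {v} → ¬ Before i j (i ∷ v) → count j v ≡ 0
  ¬Before-∷⇒count≡0 {v} ¬b = decidable-stable (count j v ≟ 0) (¬b ∘ bhere ∘ count≢0⇒∈ v)

  module _ (i≢j : i ≢ j) where

    ¬Before⇒blocks : ∀ {v} → All (Pair i j) v → ¬ Before i j v →
                     v ≡ replicate (count j v) j ++ replicate (count i v) i
    ¬Before⇒blocks [] _ = refl
    ¬Before⇒blocks {j ∷ v} (inj₂ refl ∷ ps) ¬b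
      rewrite count-here j v | count-there v (≢-sym i≢j) =
      cong (j ∷_) (¬Before⇒blocks ps (¬b ∘ bthere))
    ¬Before⇒blocks {i ∷ v} (inj₁ refl ∷ ps) ¬b
      rewrite count-here i v | count-there v i≢j
      with ¬Before⇒blocks ps (¬b ∘ bthere)
    ... | v≡blocks rewrite ¬Before-∷⇒count≡0 ¬b = cong (i ∷_) v≡blocks

    ¬Before-jjii : ¬ Before i j (j ∷ j ∷ i ∷ i ∷ [])
    ¬Before-jjii (bhere _) = i≢j refl
    ¬Before-jjii (bthere (bhere _)) = i≢j refl
    ¬Before-jjii (bthere (bthere (bhere (here j≡i)))) = i≢j (sym j≡i)
    ¬Before-jjii (bthere (bthere (bthere (bhere ()))))
    ¬Before-jjii (bthere (bthere (bthere (bthere ()))))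

fresh : ℕ → Word → Word
fresh x u = if count x u ≡ᵇ 0 then x ∷ [] else []

marks : ℕ → Word → Word → Word
marks x p u = fresh x p ++ fresh x u

-- p is the prefix already read: x is marked if it is absent from p (a first occurrence)
-- and if it is absent from the rest u (a last occurrence).
endpoints : Word → Word → Word
endpoints p [] = []
endpoints p (x ∷ u) = marks x p u ++ endpoints (x ∷ p) u

markCount : ℕ → ℕ → ℕ
markCount _       zero    = 0
markCount zero    (suc _) = 2
markCount (suc _) (suc _) = 1

fresh-constant : ∀ x u → All (_≡ x) (fresh x u)
fresh-constant x u with count x u ≡ᵇ 0
... | true = refl ∷ []
... | false = []

marks-constant : ∀ x p u → All (_≡ x) (marks x p u)
marks-constant x p u = ++⁺ (fresh-constant x p) (fresh-constant x u)

count-constant-≢ : ∀ {x y v} → All (_≡ y) v → y ≢ x → count x v ≡ 0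
count-constant-≢ [] y≢x = refl
count-constant-≢ {v = z ∷ v} (refl ∷ v≡y) y≢x = trans (count-there v y≢x) (count-constant-≢ v≡y y≢x)

count-fresh : ∀ x u → count x (fresh x u) ≡ (if count x u ≡ᵇ 0 then 1 else 0)
count-fresh x u with count x u ≡ᵇ 0
... | true = count-here x []
... | false = refl

markCount-step : ∀ m n →
  (if m ≡ᵇ 0 then 1 else 0) + (if n ≡ᵇ 0 then 1 else 0) + markCount (suc m) n ≡ markCount m (suc n)
markCount-step zero    zero    = refl
markCount-step zero    (suc n) = refl
markCount-step (suc m) zero    = refl
markCount-step (suc m) (suc n) = refl

count-endpoints : ∀ x p u → count x (endpoints p u) ≡ markCount (count x p) (count x u)
count-endpoints x p [] = refl
count-endpoints x p (y ∷ u) with y ≟ x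
... | no y≢x = begin
  count x (marks y p u ++ endpoints (y ∷ p) u)
    ≡⟨ count-++ x (marks y p u) (endpoints (y ∷ p) u) ⟩
  count x (marks y p u) + count x (endpoints (y ∷ p) u)
    ≡⟨ cong₂ _+_ (count-constant-≢ (marks-constant y p u) y≢x) (count-endpoints x (y ∷ p) u) ⟩
  markCount (count x (y ∷ p)) (count x u)
    ≡⟨ cong₂ markCount (count-there p y≢x) (sym (count-there u y≢x)) ⟩
  markCount (count x p) (count x (y ∷ u)) ∎
... | yes refl = begin
  count x (marks x p u ++ endpoints (x ∷ p) u)
    ≡⟨ count-++ x (marks x p u) (endpoints (x ∷ p) u) ⟩
  count x (fresh x p ++ fresh x u) + count x (endpoints (x ∷ p) u)
    ≡⟨ cong₂ _+_ (count-++ x (fresh x p) (fresh x u)) (count-endpoints x (x ∷ p) u) ⟩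
  count x (fresh x p) + count x (fresh x u) + markCount (count x (x ∷ p)) (count x u)
    ≡⟨ cong₂ _+_ (cong₂ _+_ (count-fresh x p) (count-fresh x u))
                 (cong (λ c → markCount c (count x u)) (count-here x p)) ⟩
  (if count x p ≡ᵇ 0 then 1 else 0) + (if count x u ≡ᵇ 0 then 1 else 0)
    + markCount (suc (count x p)) (count x u)
    ≡⟨ markCount-step (count x p) (count x u) ⟩
  markCount (count x p) (suc (count x u))
    ≡⟨ cong (markCount (count x p)) (count-here x u) ⟨
  markCount (count x p) (count x (x ∷ u)) ∎

markCount≢0 : ∀ m {n} → n ≢ 0 → markCount m n ≢ 0
markCount≢0 _       {zero}  n≢0 = ⊥-elim (n≢0 refl)
markCount≢0 zero    {suc _} _   = λ ()
markCount≢0 (suc _) {suc _} _   = λ ()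

markCount-unseen : ∀ {n} → n ≢ 0 → markCount 0 n ≡ 2
markCount-unseen {zero}  n≢0 = ⊥-elim (n≢0 refl)
markCount-unseen {suc _} _   = refl

∈-endpoints⁻ : ∀ {x} p u → x ∈ endpoints p u → x ∈ u
∈-endpoints⁻ p (y ∷ u) x∈ with ∈-++⁻ (marks y p u) x∈
... | inj₁ x∈marks = here (All.lookup (marks-constant y p u) x∈marks)
... | inj₂ x∈rest = there (∈-endpoints⁻ (y ∷ p) u x∈rest)

∈-endpoints⁺ : ∀ {x} p u → x ∈ u → x ∈ endpoints p u
∈-endpoints⁺ {x} p u x∈u = count≢0⇒∈ (endpoints p u)
  (subst (_≢ 0) (sym (count-endpoints x p u)) (markCount≢0 (count x p) (∈⇒count≢0 x∈u)))

endpoints-uniform : ∀ u → Uniform 2 (endpoints [] u)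
endpoints-uniform u x x∈ = trans (count-endpoints x [] u)
  (markCount-unseen (∈⇒count≢0 (∈-endpoints⁻ [] u x∈)))

endpoints-alph : ∀ u x → (x ∈ endpoints [] u) ⇔ (x ∈ u)
endpoints-alph u x = mk⇔ (∈-endpoints⁻ [] u) (∈-endpoints⁺ [] u)

module _ {i j : ℕ} where

  Before-endpoints⁻ : i ≢ j → ∀ p u → Before i j (endpoints p u) → Before i j u
  Before-endpoints⁻ i≢j p (x ∷ u) b with Before-constant-++⁻ i≢j (marks-constant x p u) b
  ... | inj₁ (refl , j∈rest) = bhere (∈-endpoints⁻ (x ∷ p) u j∈rest)
  ... | inj₂ b′ = bthere (Before-endpoints⁻ i≢j (x ∷ p) u b′)

  Before-endpoints⁺ : ∀ {p u} → count i p ≡ 0 → Before i j u → Before i j (endpoints p u)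
  Before-endpoints⁺ {p} {x ∷ u} i∉p b with x ≟ i
  ... | yes refl rewrite i∉p = bhere (∈-++⁺ʳ (fresh x u) (∈-endpoints⁺ (x ∷ p) u (Before-∷⇒∈ b)))
  ... | no x≢i with b
  ...   | bhere _ = ⊥-elim (x≢i refl)
  ...   | bthere b′ = Before-++⁺ʳ (marks x p u) (Before-endpoints⁺ (trans (count-there p x≢i) i∉p) b′)

module _ {i j : ℕ} (i≢j : i ≢ j) where

  ¬Before⇒proj-endpoints : ∀ {u} → i ∈ u → j ∈ u → ¬ Before i j u →
                           proj i j (endpoints [] u) ≡ j ∷ j ∷ i ∷ i ∷ []
  ¬Before⇒proj-endpoints {u} i∈u j∈u ¬b = begin
    proj i j e
      ≡⟨ ¬Before⇒blocks i≢j (proj-pair i j e) ¬b′ ⟩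
    replicate (count j (proj i j e)) j ++ replicate (count i (proj i j e)) i
      ≡⟨ cong₂ (λ m n → replicate m j ++ replicate n i)
               (count-proj-e (inj₂ refl) j∈u) (count-proj-e (inj₁ refl) i∈u) ⟩
    j ∷ j ∷ i ∷ i ∷ [] ∎
    where
    e = endpoints [] u
    ¬b′ : ¬ Before i j (proj i j e)
    ¬b′ = ¬b ∘ Before-endpoints⁻ i≢j [] u ∘ Before-proj⁻ e
    count-proj-e : ∀ {x} → Pair i j x → x ∈ u → count x (proj i j e) ≡ 2
    count-proj-e {x} px x∈u = trans (count-proj px e) (endpoints-uniform u x (∈-endpoints⁺ [] u x∈u))

  ¬Before⇔proj-endpoints : ∀ {u} → i ∈ u → j ∈ u →
                           (¬ Before i j u) ⇔ (proj i j (endpoints [] u) ≡ j ∷ j ∷ i ∷ i ∷ [])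
  ¬Before⇔proj-endpoints i∈u j∈u = mk⇔ (¬Before⇒proj-endpoints i∈u j∈u)
    (λ eq b → ¬Before-jjii i≢j (subst (Before i j) eq (Before-proj⁺ (Before-endpoints⁺ refl b))))

module _ {u d : Word} (d↓ : AllPairs _≥_ d) (u⊆d : u ⊆ d) where

  no12⇔endpoints-agree< : ∀ {i j} → i < j → i ∈ u → j ∈ u →
    (¬ Has12 (proj i j u)) ⇔ (proj i j (endpoints [] u) ≡ proj i j (endpoints [] d))
  no12⇔endpoints-agree< {i} {j} i<j i∈u j∈u =
    agree ⇔-∘ (¬Before⇔proj-endpoints (<⇒≢ i<j) i∈u j∈u ⇔-∘ ¬-cong-⇔ (Has12-proj⇔Before i<j u))
    where
    d-jjii : proj i j (endpoints [] d) ≡ j ∷ j ∷ i ∷ i ∷ []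
    d-jjii = ¬Before⇒proj-endpoints (<⇒≢ i<j) (u⊆d i∈u) (u⊆d j∈u) (AllPairs≥⇒¬Before i<j d↓)
    agree : (proj i j (endpoints [] u) ≡ j ∷ j ∷ i ∷ i ∷ []) ⇔
            (proj i j (endpoints [] u) ≡ proj i j (endpoints [] d))
    agree = mk⇔ (λ eq → trans eq (sym d-jjii)) (λ eq → trans eq d-jjii)

  no12⇔endpoints-agree : ∀ {i j} → i ≢ j → i ∈ u → j ∈ u →
    (¬ Has12 (proj i j u)) ⇔ (proj i j (endpoints [] u) ≡ proj i j (endpoints [] d))
  no12⇔endpoints-agree {i} {j} i≢j i∈u j∈u with <-cmp i j
  ... | tri< i<j _ _ = no12⇔endpoints-agree< i<j i∈u j∈u
  ... | tri≈ _ i≡j _ = ⊥-elim (i≢j i≡j)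
  ... | tri> _ _ j<i
    rewrite proj-comm i j u | proj-comm i j (endpoints [] u) | proj-comm i j (endpoints [] d) =
    no12⇔endpoints-agree< j<i j∈u i∈u

≥-decTotalOrder : DecTotalOrder 0ℓ 0ℓ 0ℓ
≥-decTotalOrder = Flip.decTotalOrder ≤-decTotalOrder

open Sort ≥-decTotalOrder using () renaming (sort to sort≥; sort-↭ to sort≥-↭; sort-↗ to sort≥-sorted)

sort≥-descending : ∀ u → AllPairs _≥_ (sort≥ u)
sort≥-descending u = Sorted⇒AllPairs (DecTotalOrder.totalOrder ≥-decTotalOrder) (sort≥-sorted u)

theorem8 : (G : Graph) → Rep12 G → InGk 2 G
theorem8 G (w , alph , rep) =
  endpoints [] w , endpoints [] d , endpoints-uniform w , endpoints-uniform d , alph-w , alph-d , edges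
  where
  d : Word
  d = sort≥ w
  w⊆d : w ⊆ d
  w⊆d = ∈-resp-↭ (↭-sym (sort≥-↭ w))
  d⊆w : d ⊆ w
  d⊆w = ∈-resp-↭ (sort≥-↭ w)
  alph-w : AlphIs (endpoints [] w) (V G)
  alph-w x = alph x ⇔-∘ endpoints-alph w x
  alph-d : AlphIs (endpoints [] d) (V G)
  alph-d x = alph x ⇔-∘ (mk⇔ d⊆w w⊆d ⇔-∘ endpoints-alph d x)
  edges : ∀ a b → a ∈ V G → b ∈ V G → a ≢ b →
          E G a b ⇔ (proj a b (endpoints [] w) ≡ proj a b (endpoints [] d))
  edges a b a∈V b∈V a≢b =
    no12⇔endpoints-agree (sort≥-descending w) w⊆d a≢b
      (Equivalence.from (alph a) a∈V) (Equivalence.from (alph b) b∈V)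
    ⇔-∘ rep a b a∈V b∈V a≢b
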